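{- Let $D=(E,\mathcal{F})$ be a set system, let $A$ be a feasible set of $D$ of minimum cardinality, and let $B$ be a feasible set of $D^{*}$ of minimum cardinality. Then (1) $D^{\bullet|A}$ is normal for every $\bullet\in\{*,*\times,\times*,*\times*\}$; (2) $D^{\times|B}$ is dual normal.
   Context: A set system is a pair $D=(E,\mathcal{F})$ with $E$ finite and $\mathcal{F}$ a collection of subsets of $E$; it is normal if $\emptyset\in\mathcal{F}$ and dual normal if $E\in\mathcal{F}$. For $A\subseteq E$, $D^{*|A}=(E,\{A\Delta X:X\in\mathcal{F}\})$ and $D^{*}=D^{*|E}$. For $e\in E$, $D^{\times|e}=(E,\mathcal{F}\Delta\{F\cup e:F\in\mathcal{F},e\notin F\})$. For a word $a=a_1\cdots a_n$ in $\{*,\times\}$, $D^{a|e}$ means applying $a_1|e$, then $a_2|e$, etc.; $D^{a|A}$ for $A=\{e_1,\dots,e_m\}$ means applying $a|e_1,\dots,a|e_m$ in turn (operations on distinct elements commute). -}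

module Defs where

open import Data.Nat using (ℕ; _≤_)
open import Data.Bool using (Bool; true; false; _xor_; _∧_; if_then_else_)
open import Data.Fin using (Fin)
open import Data.Fin.Subset using (Subset; ⁅_⁆; ∣_∣; ⊥; ⊤; _-_)
open import Data.Vec using (lookup; zipWith)
open import Data.List using (List; []; _∷_; foldl)
open import Data.List using (allFin) public
open import Relation.Binary.PropositionalEquality using (_≡_)

record SetSystem (n : ℕ) : Set where
  constructor ⟨_⟩
  field
    𝓕 : Subset n → Bool
open SetSystem public

Feasible : ∀ {n} → SetSystem n → Subset n → Set
Feasible D X = 𝓕 D X ≡ true

MinFeasible : ∀ {n} → SetSystem n → Subset n → Set
MinFeasible D A = Feasible D A × (∀ X → Feasible D X → ∣ A ∣ ≤ ∣ X ∣)
  where open import Data.Product using (_×_)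

Normal : ∀ {n} → SetSystem n → Set
Normal D = Feasible D ⊥

DualNormal : ∀ {n} → SetSystem n → Set
DualNormal D = Feasible D ⊤

_Δ_ : ∀ {n} → Subset n → Subset n → Subset n
_Δ_ = zipWith _xor_

-- twist: D^{*|A} = (E, {A Δ X : X ∈ 𝓕});  Y = A Δ X  iff  X = A Δ Y
twist : ∀ {n} → SetSystem n → Subset n → SetSystem n
twist D A = ⟨ (λ Y → 𝓕 D (A Δ Y)) ⟩

dual : ∀ {n} → SetSystem n → SetSystem n
dual D = twist D ⊤

-- loop: D^{×|e} = (E, 𝓕 Δ {F ∪ e : F ∈ 𝓕, e ∉ F});
-- Y ∈ {F ∪ e : F ∈ 𝓕, e ∉ F}  iff  e ∈ Y and Y - e ∈ 𝓕
loop : ∀ {n} → SetSystem n → Fin n → SetSystem n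
loop D e = ⟨ (λ Y → 𝓕 D Y xor (lookup Y e ∧ 𝓕 D (Y - e))) ⟩

data Op : Set where
  star cross : Op

applyOp : ∀ {n} → SetSystem n → Op → Fin n → SetSystem n
applyOp D star e = twist D ⁅ e ⁆
applyOp D cross e = loop D e

-- D^{a|e} for a word a = a₁⋯aₖ : apply a₁|e, then a₂|e, ...
applyWord : ∀ {n} → SetSystem n → List Op → Fin n → SetSystem n
applyWord D w e = foldl (λ D' o → applyOp D' o e) D w

-- D^{a|A}, A = {e₁,…,eₘ}: apply a|e₁, …, a|eₘ in turn
-- (elements taken in increasing order; order is irrelevant by commutation)
applyWordSet : ∀ {n} → SetSystem n → List Op → Subset n → SetSystem n
applyWordSet D w A =
  foldl (λ D' e → if lookup A e then applyWord D' w e else D') D (allFin _)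

{-# OPTIONS --safe #-}

-- Each operation at an element x only mixes the two values of 𝓕 at
-- Y [ x ]≔ false and Y [ x ]≔ true.  For the words *, *×, ×* and *×* the new
-- false-value is the old true-value as soon as the old false-value vanishes;
-- for × the same holds with the two values exchanged.  Sweeping through A and
-- evaluating at ∅, each of these side conditions is the infeasibility of a
-- proper subset of A, and what survives is the feasibility of A.  Sweeping
-- through B and evaluating at E, the side conditions are the infeasibility in
-- D* of proper subsets of B, and what survives is the feasibility of B in D*.
module Submission where

open import Defs
open import Data.Bool using (Bool; true; false; not; _xor_; _∧_; if_then_else_)
open import Data.Bool.Properties using (xor-comm; xor-assoc; xor-same; xor-identityʳ)
open import Data.Empty using (⊥-elim)
open import Data.Fin using (Fin; zero; suc; _≟_)
open import Data.Fin.Subset using (Subset; ⁅_⁆; ⊥; ⊤; _-_; _∈_; _⊆_)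
open import Data.Fin.Subset.Properties using (p⊂q⇒∣p∣<∣q∣; p─⊥≡p; ⊆-refl)
open import Data.List using (List; []; _∷_; foldl)
import Data.List.Membership.Propositional as List
open import Data.List.Membership.Propositional.Properties using (∈-allFin)
open import Data.List.Relation.Unary.All as All using (All; []; _∷_)
open import Data.List.Relation.Unary.AllPairs using (_∷_)
open import Data.List.Relation.Unary.Any using (here; there)
open import Data.List.Relation.Unary.Unique.Propositional using (Unique)
open import Data.List.Relation.Unary.Unique.Propositional.Properties using (allFin⁺)
open import Data.Nat.Properties using (<⇒≱)
open import Data.Product using (_×_; _,_; proj₁)
open import Data.Vec using ([]; _∷_; lookup; replicate; _[_]≔_)
open import Data.Vec.Properties
  using (lookup∘update; lookup∘update′; []≔-idempotent; []≔-lookup; lookup-replicate; []=⇒lookup; lookup⇒[]=)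
open import Data.Vec.Relation.Binary.Pointwise.Extensional using (ext; Pointwise-≡⇒≡)
open import Relation.Nullary using (yes; no)
open import Relation.Binary.PropositionalEquality
open ≡-Reasoning

Δ-identityˡ : ∀ {n} (Y : Subset n) → ⊥ Δ Y ≡ Y
Δ-identityˡ []      = refl
Δ-identityˡ (y ∷ Y) = cong (y ∷_) (Δ-identityˡ Y)

Δ-comm : ∀ {n} (U V : Subset n) → U Δ V ≡ V Δ U
Δ-comm []      []      = refl
Δ-comm (u ∷ U) (v ∷ V) = cong₂ _∷_ (xor-comm u v) (Δ-comm U V)

Δ-cancelˡ : ∀ {n} (U V : Subset n) → U Δ (U Δ V) ≡ V
Δ-cancelˡ []      []      = refl
Δ-cancelˡ (u ∷ U) (v ∷ V) =
  cong₂ _∷_ (trans (sym (xor-assoc u u v)) (cong (_xor v) (xor-same u))) (Δ-cancelˡ U V)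

Δ-[]≔ : ∀ {n} (U Y : Subset n) x c → U Δ (Y [ x ]≔ c) ≡ (U Δ Y) [ x ]≔ (lookup U x xor c)
Δ-[]≔ (u ∷ U) (y ∷ Y) zero    c = refl
Δ-[]≔ (u ∷ U) (y ∷ Y) (suc x) c = cong ((u xor y) ∷_) (Δ-[]≔ U Y x c)

[]≔-Δ : ∀ {n} (U Y : Subset n) x c → (U [ x ]≔ c) Δ Y ≡ (U Δ Y) [ x ]≔ (c xor lookup Y x)
[]≔-Δ (u ∷ U) (y ∷ Y) zero    c = refl
[]≔-Δ (u ∷ U) (y ∷ Y) (suc x) c = cong ((u xor y) ∷_) ([]≔-Δ U Y x c)

⁅x⁆Δp≡p[x]≔not : ∀ {n} x (Y : Subset n) → ⁅ x ⁆ Δ Y ≡ Y [ x ]≔ not (lookup Y x)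
⁅x⁆Δp≡p[x]≔not zero    (y ∷ Y) = cong (not y ∷_) (Δ-identityˡ Y)
⁅x⁆Δp≡p[x]≔not (suc x) (y ∷ Y) = cong (y ∷_) (⁅x⁆Δp≡p[x]≔not x Y)

p-x≡p[x]≔false : ∀ {n} (Y : Subset n) x → Y - x ≡ Y [ x ]≔ false
p-x≡p[x]≔false (y ∷ Y) zero    = cong (false ∷_) (p─⊥≡p Y)
p-x≡p[x]≔false (y ∷ Y) (suc x) = cong (y ∷_) (p-x≡p[x]≔false Y x)

⊆-[]≔ : ∀ {n} {Z A : Subset n} {x} c → Z ⊆ A → x ∈ A → Z [ x ]≔ c ⊆ A
⊆-[]≔ {Z = Z} {x = x} c Z⊆A x∈A {e} e∈Z′ with e ≟ x
... | yes refl = x∈A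
... | no e≢x   = Z⊆A (lookup⇒[]= e Z (trans (sym (lookup∘update′ e≢x Z c)) ([]=⇒lookup e∈Z′)))

minFeasible-[]≔false : ∀ {n} {G : SetSystem n} {A Z : Subset n} {x} →
  MinFeasible G A → Z ⊆ A → x ∈ A → 𝓕 G (Z [ x ]≔ false) ≡ false
minFeasible-[]≔false {G = G} {A} {Z} {x} (_ , minimal) Z⊆A x∈A with 𝓕 G (Z [ x ]≔ false) in feasible
... | false = refl
... | true  = ⊥-elim (<⇒≱ (p⊂q⇒∣p∣<∣q∣ (⊆-[]≔ false Z⊆A x∈A , x , x∈A , x∉Z′)) (minimal _ feasible))
  where
  x∉Z′ : x ∈ Z [ x ]≔ false → _
  x∉Z′ x∈Z′ with () ← trans (sym (lookup∘update x Z false)) ([]=⇒lookup x∈Z′)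

Δ-[]≔-⊆ : ∀ {n} (U : Subset n) {Z A x} c → U Δ Z ⊆ A → x ∈ A → U Δ (Z [ x ]≔ c) ⊆ A
Δ-[]≔-⊆ U {Z} {x = x} c UΔZ⊆A x∈A = subst (_⊆ _) (sym (Δ-[]≔ U Z x c)) (⊆-[]≔ _ UΔZ⊆A x∈A)

dual-minFeasible-[]≔true : ∀ {n} {D : SetSystem n} {B Z : Subset n} {x} →
  MinFeasible (dual D) B → ⊤ Δ Z ⊆ B → x ∈ B → 𝓕 D (Z [ x ]≔ true) ≡ false
dual-minFeasible-[]≔true {D = D} {B} {Z} {x} minimal ⊤ΔZ⊆B x∈B = begin
  𝓕 D (Z [ x ]≔ true)                               ≡⟨ cong (𝓕 D) (sym (Δ-cancelˡ ⊤ _)) ⟩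
  𝓕 (dual D) (⊤ Δ (Z [ x ]≔ true))                  ≡⟨ cong (𝓕 (dual D)) (Δ-[]≔ ⊤ Z x true) ⟩
  𝓕 (dual D) ((⊤ Δ Z) [ x ]≔ (lookup ⊤ x xor true)) ≡⟨ cong (λ d → 𝓕 (dual D) ((⊤ Δ Z) [ x ]≔ (d xor true))) (lookup-replicate x true) ⟩
  𝓕 (dual D) ((⊤ Δ Z) [ x ]≔ false)                 ≡⟨ minFeasible-[]≔false minimal ⊤ΔZ⊆B x∈B ⟩
  false                                             ∎

twist-⁅⁆-[]≔ : ∀ {n} (G : SetSystem n) x Y c →
  𝓕 (twist G ⁅ x ⁆) (Y [ x ]≔ c) ≡ 𝓕 G (Y [ x ]≔ not c)
twist-⁅⁆-[]≔ G x Y c = cong (𝓕 G) (begin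
  ⁅ x ⁆ Δ (Y [ x ]≔ c)                               ≡⟨ ⁅x⁆Δp≡p[x]≔not x (Y [ x ]≔ c) ⟩
  (Y [ x ]≔ c) [ x ]≔ not (lookup (Y [ x ]≔ c) x)    ≡⟨ cong (λ d → (Y [ x ]≔ c) [ x ]≔ not d) (lookup∘update x Y c) ⟩
  (Y [ x ]≔ c) [ x ]≔ not c                          ≡⟨ []≔-idempotent Y x ⟩
  Y [ x ]≔ not c                                     ∎)

loop-[]≔ : ∀ {n} (G : SetSystem n) x Y c →
  𝓕 (loop G x) (Y [ x ]≔ c) ≡ 𝓕 G (Y [ x ]≔ c) xor (c ∧ 𝓕 G (Y [ x ]≔ false))
loop-[]≔ G x Y c = cong₂ (λ d Y′ → 𝓕 G (Y [ x ]≔ c) xor (d ∧ 𝓕 G Y′))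
  (lookup∘update x Y c)
  (trans (p-x≡p[x]≔false (Y [ x ]≔ c) x) ([]≔-idempotent Y x))

FlipsSlot : Bool → List Op → Set
FlipsSlot b w = ∀ {n} (G : SetSystem n) x Y → 𝓕 G (Y [ x ]≔ b) ≡ false →
  𝓕 (applyWord G w x) (Y [ x ]≔ b) ≡ 𝓕 G (Y [ x ]≔ not b)

star-flips : FlipsSlot false (star ∷ [])
star-flips G x Y _ = twist-⁅⁆-[]≔ G x Y false

star-cross-flips : FlipsSlot false (star ∷ cross ∷ [])
star-cross-flips G x Y _ = begin
  𝓕 (loop (twist G ⁅ x ⁆) x) (Y [ x ]≔ false)        ≡⟨ loop-[]≔ (twist G ⁅ x ⁆) x Y false ⟩
  𝓕 (twist G ⁅ x ⁆) (Y [ x ]≔ false) xor false       ≡⟨ xor-identityʳ _ ⟩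
  𝓕 (twist G ⁅ x ⁆) (Y [ x ]≔ false)                 ≡⟨ twist-⁅⁆-[]≔ G x Y false ⟩
  𝓕 G (Y [ x ]≔ true)                                ∎

cross-star-flips : FlipsSlot false (cross ∷ star ∷ [])
cross-star-flips G x Y empty = begin
  𝓕 (twist (loop G x) ⁅ x ⁆) (Y [ x ]≔ false)        ≡⟨ twist-⁅⁆-[]≔ (loop G x) x Y false ⟩
  𝓕 (loop G x) (Y [ x ]≔ true)                       ≡⟨ loop-[]≔ G x Y true ⟩
  𝓕 G (Y [ x ]≔ true) xor 𝓕 G (Y [ x ]≔ false)       ≡⟨ cong (𝓕 G (Y [ x ]≔ true) xor_) empty ⟩
  𝓕 G (Y [ x ]≔ true) xor false                      ≡⟨ xor-identityʳ _ ⟩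
  𝓕 G (Y [ x ]≔ true)                                ∎

star-cross-star-flips : FlipsSlot false (star ∷ cross ∷ star ∷ [])
star-cross-star-flips G x Y empty = begin
  𝓕 (twist (loop (twist G ⁅ x ⁆) x) ⁅ x ⁆) (Y [ x ]≔ false)
    ≡⟨ twist-⁅⁆-[]≔ (loop (twist G ⁅ x ⁆) x) x Y false ⟩
  𝓕 (loop (twist G ⁅ x ⁆) x) (Y [ x ]≔ true)
    ≡⟨ loop-[]≔ (twist G ⁅ x ⁆) x Y true ⟩
  𝓕 (twist G ⁅ x ⁆) (Y [ x ]≔ true) xor 𝓕 (twist G ⁅ x ⁆) (Y [ x ]≔ false)
    ≡⟨ cong₂ _xor_ (twist-⁅⁆-[]≔ G x Y true) (twist-⁅⁆-[]≔ G x Y false) ⟩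
  𝓕 G (Y [ x ]≔ false) xor 𝓕 G (Y [ x ]≔ true)
    ≡⟨ cong (_xor 𝓕 G (Y [ x ]≔ true)) empty ⟩
  𝓕 G (Y [ x ]≔ true)
    ∎

cross-flips : FlipsSlot true (cross ∷ [])
cross-flips G x Y empty = begin
  𝓕 (loop G x) (Y [ x ]≔ true)                       ≡⟨ loop-[]≔ G x Y true ⟩
  𝓕 G (Y [ x ]≔ true) xor 𝓕 G (Y [ x ]≔ false)       ≡⟨ cong (_xor 𝓕 G (Y [ x ]≔ false)) empty ⟩
  𝓕 G (Y [ x ]≔ false)                               ∎

-- T is the set of elements of A processed so far; Inv T G says that the
-- intermediate system G is D twisted by T, on the Y that are constantly b on T
-- and whose twist is admissible.
module Sweep {n} (D : SetSystem n) (A : Subset n) (b : Bool) (Admissible : Subset n → Set)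
  (admissible-[]≔ : ∀ {Z x} c → Admissible Z → x ∈ A → Admissible (Z [ x ]≔ c))
  (vanishes : ∀ {Z x} → Admissible Z → x ∈ A → 𝓕 D (Z [ x ]≔ b) ≡ false)
  where

  Inv : Subset n → SetSystem n → Set
  Inv T G = ∀ Y → (∀ e → lookup T e ≡ true → lookup Y e ≡ b) → Admissible (T Δ Y) →
    𝓕 G Y ≡ 𝓕 D (T Δ Y)

  inv-⊥ : Inv ⊥ D
  inv-⊥ Y _ _ = cong (𝓕 D) (sym (Δ-identityˡ Y))

  inv-flip : ∀ {w} → FlipsSlot b w → ∀ {T G x} → x ∈ A → lookup T x ≡ false →
    Inv T G → Inv (T [ x ]≔ true) (applyWord G w x)
  inv-flip {w} flips {T} {G} {x} x∈A Tx≡false inv Y constant admissible = begin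
    𝓕 (applyWord G w x) Y                 ≡⟨ cong (𝓕 (applyWord G w x)) (sym Y[x]≔b≡Y) ⟩
    𝓕 (applyWord G w x) (Y [ x ]≔ b)      ≡⟨ flips G x Y (trans (inv-slot b admissible-b) b-slot-empty) ⟩
    𝓕 G (Y [ x ]≔ not b)                  ≡⟨ inv-slot (not b) admissible-not-b ⟩
    𝓕 D ((T Δ Y) [ x ]≔ not b)            ≡⟨ cong (𝓕 D) (sym T′ΔY) ⟩
    𝓕 D ((T [ x ]≔ true) Δ Y)             ∎
    where
    Yx≡b : lookup Y x ≡ b
    Yx≡b = constant x (lookup∘update x T true)

    Y[x]≔b≡Y : Y [ x ]≔ b ≡ Y
    Y[x]≔b≡Y = trans (cong (Y [ x ]≔_) (sym Yx≡b)) ([]≔-lookup Y x)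

    T′ΔY : (T [ x ]≔ true) Δ Y ≡ (T Δ Y) [ x ]≔ not b
    T′ΔY = trans ([]≔-Δ T Y x true) (cong (λ d → (T Δ Y) [ x ]≔ not d) Yx≡b)

    admissible-not-b : Admissible ((T Δ Y) [ x ]≔ not b)
    admissible-not-b = subst Admissible T′ΔY admissible

    admissible-b : Admissible ((T Δ Y) [ x ]≔ b)
    admissible-b = subst Admissible ([]≔-idempotent (T Δ Y) x) (admissible-[]≔ {(T Δ Y) [ x ]≔ not b} b admissible-not-b x∈A)

    b-slot-empty : 𝓕 D ((T Δ Y) [ x ]≔ b) ≡ false
    b-slot-empty = trans (cong (𝓕 D) (sym ([]≔-idempotent (T Δ Y) x)))
      (vanishes {(T Δ Y) [ x ]≔ not b} admissible-not-b x∈A)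

    inv-slot : ∀ c → Admissible ((T Δ Y) [ x ]≔ c) → 𝓕 G (Y [ x ]≔ c) ≡ 𝓕 D ((T Δ Y) [ x ]≔ c)
    inv-slot c adm = trans (inv (Y [ x ]≔ c) constant′ (subst Admissible (sym TΔY′) adm)) (cong (𝓕 D) TΔY′)
      where
      TΔY′ : T Δ (Y [ x ]≔ c) ≡ (T Δ Y) [ x ]≔ c
      TΔY′ = trans (Δ-[]≔ T Y x c) (cong (λ d → (T Δ Y) [ x ]≔ (d xor c)) Tx≡false)

      constant′ : ∀ e → lookup T e ≡ true → lookup (Y [ x ]≔ c) e ≡ b
      constant′ e Te≡true = trans (lookup∘update′ e≢x Y c) (constant e (trans (lookup∘update′ e≢x T true) Te≡true))
        where
        e≢x : e ≢ x
        e≢x refl with () ← trans (sym Tx≡false) Te≡true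

  step : List Op → SetSystem n → Fin n → SetSystem n
  step w G x = if lookup A x then applyWord G w x else G

  mark : Subset n → Fin n → Subset n
  mark T x = T [ x ]≔ lookup A x

  inv-step : ∀ {w} → FlipsSlot b w → ∀ {T G x} → lookup T x ≡ false → Inv T G → Inv (mark T x) (step w G x)
  inv-step {w} flips {T} {G} {x} Tx≡false inv with lookup A x in Ax
  ... | true  = inv-flip {w} flips (lookup⇒[]= x A Ax) Tx≡false inv
  ... | false = subst (λ T′ → Inv T′ G) (sym (trans (cong (T [ x ]≔_) (sym Tx≡false)) ([]≔-lookup T x))) inv

  inv-sweep : ∀ {w} → FlipsSlot b w → ∀ L {T G} → Unique L → (∀ {x} → x List.∈ L → lookup T x ≡ false) →
    Inv T G → Inv (foldl mark T L) (foldl (step w) G L)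
  inv-sweep flips []      _              _        inv = inv
  inv-sweep {w} flips (x ∷ L) {T} (x∉L ∷ unique) unmarked inv =
    inv-sweep {w} flips L unique unmarked′ (inv-step {w} flips (unmarked (here refl)) inv)
    where
    unmarked′ : ∀ {y} → y List.∈ L → lookup (mark T x) y ≡ false
    unmarked′ y∈L = trans (lookup∘update′ (≢-sym (All.lookup x∉L y∈L)) T _) (unmarked (there y∈L))

  foldl-mark-∉ : ∀ L {T e} → All (e ≢_) L → lookup (foldl mark T L) e ≡ lookup T e
  foldl-mark-∉ []      []             = refl
  foldl-mark-∉ (x ∷ L) {T} (e≢x ∷ e∉L) = trans (foldl-mark-∉ L e∉L) (lookup∘update′ e≢x T _)

  foldl-mark-∈ : ∀ L {T e} → Unique L → e List.∈ L → lookup (foldl mark T L) e ≡ lookup A e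
  foldl-mark-∈ (x ∷ L) {T} (x∉L ∷ _) (here refl)  = trans (foldl-mark-∉ L x∉L) (lookup∘update x T _)
  foldl-mark-∈ (x ∷ L)     (_ ∷ unique) (there e∈L) = foldl-mark-∈ L unique e∈L

  foldl-mark-allFin : foldl mark ⊥ (allFin n) ≡ A
  foldl-mark-allFin = Pointwise-≡⇒≡ (ext λ e → foldl-mark-∈ (allFin n) (allFin⁺ n) (∈-allFin e))

  applyWordSet-constant : ∀ {w} → FlipsSlot b w → Admissible (A Δ replicate n b) →
    𝓕 (applyWordSet D w A) (replicate n b) ≡ 𝓕 D (A Δ replicate n b)
  applyWordSet-constant {w} flips admissible =
    subst (λ T → Inv T (applyWordSet D w A)) foldl-mark-allFin
      (inv-sweep {w} flips (allFin n) (allFin⁺ n) (λ {x} _ → lookup-replicate x false) inv-⊥)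
      (replicate n b) (λ e _ → lookup-replicate e b) admissible

mainTheorem3 : ∀ {n} (D : SetSystem n) (A B : Subset n) →
    MinFeasible D A → MinFeasible (dual D) B →
    (Normal (applyWordSet D (star ∷ []) A)
      × Normal (applyWordSet D (star ∷ cross ∷ []) A)
      × Normal (applyWordSet D (cross ∷ star ∷ []) A)
      × Normal (applyWordSet D (star ∷ cross ∷ star ∷ []) A))
    × DualNormal (applyWordSet D (cross ∷ []) B)
mainTheorem3 D A B minA minB =
  ( normal {star ∷ []} star-flips
  , normal {star ∷ cross ∷ []} star-cross-flips
  , normal {cross ∷ star ∷ []} cross-star-flips
  , normal {star ∷ cross ∷ star ∷ []} star-cross-star-flips )
  , dualNormal
  where
  module Primal = Sweep D A false (_⊆ A) ⊆-[]≔ (minFeasible-[]≔false minA)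
  module Dual = Sweep D B true (λ Z → ⊤ Δ Z ⊆ B) (Δ-[]≔-⊆ ⊤) (dual-minFeasible-[]≔true {D = D} minB)

  AΔ⊥≡A : A Δ ⊥ ≡ A
  AΔ⊥≡A = trans (Δ-comm A ⊥) (Δ-identityˡ A)

  ⊤ΔBΔ⊤≡B : ⊤ Δ (B Δ ⊤) ≡ B
  ⊤ΔBΔ⊤≡B = trans (cong (⊤ Δ_) (Δ-comm B ⊤)) (Δ-cancelˡ ⊤ B)

  normal : ∀ {w} → FlipsSlot false w → Normal (applyWordSet D w A)
  normal {w} flips = begin
    𝓕 (applyWordSet D w A) ⊥ ≡⟨ Primal.applyWordSet-constant {w} flips (subst (_⊆ A) (sym AΔ⊥≡A) ⊆-refl) ⟩
    𝓕 D (A Δ ⊥)              ≡⟨ cong (𝓕 D) AΔ⊥≡A ⟩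
    𝓕 D A                    ≡⟨ proj₁ minA ⟩
    true                     ∎

  dualNormal : DualNormal (applyWordSet D (cross ∷ []) B)
  dualNormal = begin
    𝓕 (applyWordSet D (cross ∷ []) B) ⊤
      ≡⟨ Dual.applyWordSet-constant {cross ∷ []} cross-flips (subst (_⊆ B) (sym ⊤ΔBΔ⊤≡B) ⊆-refl) ⟩
    𝓕 D (B Δ ⊤)
      ≡⟨ cong (𝓕 D) (Δ-comm B ⊤) ⟩
    𝓕 (dual D) B
      ≡⟨ proj₁ minB ⟩
    true
      ∎
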